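{- Let $m\ge 2$ and let $S$ be a contiguous stepping sequence for $m$. Then $S$ or its reverse has first element congruent to $m-1 \pmod 2$ and last element congruent to $1\pmod 2$.
   Context: Let $n\ge1$ and start with nested sets $S_i=\{1,\ldots,i\}$, $0\le i\le n$. A move with index $i$ ($1\le i\le n-1$) replaces $S_i$ by $S_{i-1}\cup(S_{i+1}\setminus S_i)$; the set produced is the new $S_i$. A sequence $[i_1,\ldots,i_N]$ with entries in $\{1,\ldots,n-1\}$ is a stepping sequence for $n$ if the initial sets $S_0,\ldots,S_n$ together with the sets produced by the successive moves $i_1,\ldots,i_N$ contain every subset of $\{1,\ldots,n\}$ exactly once. A sequence of integers is contiguous if consecutive entries differ by $\pm1$. The reverse of $[i_1,\ldots,i_N]$ is $[i_N,\ldots,i_1]$. -}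

module Defs where

open import Data.Bool using (Bool; true; false; if_then_else_)
open import Data.Nat using (ℕ; zero; suc; _∸_; _≤_; _%_; _<ᵇ_; _≡ᵇ_)
open import Data.Fin using (Fin; toℕ)
open import Data.Fin.Subset using (Subset; _∪_; _∩_; ∁)
open import Data.Vec using (tabulate)
open import Data.List using (List; []; _∷_; map; _++_; upTo; head; last; reverse)
open import Data.List.Relation.Unary.All using (All)
open import Data.List.Relation.Unary.Linked using (Linked)
open import Data.List.Relation.Unary.Unique.Propositional using (Unique)
open import Data.List.Membership.Propositional using (_∈_)
open import Data.Maybe using (Maybe; just)
open import Data.Product using (_×_; ∃₂)
open import Data.Sum using (_⊎_)
open import Relation.Binary.PropositionalEquality using (_≡_)

-- Element k ∈ {1..n} of the ground set is encoded as the index k-1 : Fin n.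
-- A family of sets S_0, S_1, ... is a function ℕ → Subset n.
Family : ℕ → Set
Family n = ℕ → Subset n

-- initial sets S_i = {1,...,i}, i.e. indices k-1 with k-1 < i
initS : (n : ℕ) → Family n
initS n i = tabulate (λ k → toℕ k <ᵇ i)

newSet : {n : ℕ} → Family n → ℕ → Subset n
newSet S i = S (i ∸ 1) ∪ (S (suc i) ∩ ∁ (S i))

move : {n : ℕ} → Family n → ℕ → Family n
move S i j = if j ≡ᵇ i then newSet S i else S j

produced : {n : ℕ} → Family n → List ℕ → List (Subset n)
produced S []       = []
produced S (i ∷ is) = newSet S i ∷ produced (move S i) is

allSets : (n : ℕ) → List ℕ → List (Subset n)
allSets n seq = map (initS n) (upTo (suc n)) ++ produced (initS n) seq

IsStepping : ℕ → List ℕ → Set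
IsStepping n seq =
  All (λ i → 1 ≤ i × i ≤ n ∸ 1) seq
  × Unique (allSets n seq)
  × (∀ (A : Subset n) → A ∈ allSets n seq)

Contiguous : List ℕ → Set
Contiguous = Linked (λ x y → y ≡ suc x ⊎ x ≡ suc y)

GoodEnds : ℕ → List ℕ → Set
GoodEnds m L = ∃₂ λ x y → head L ≡ just x × last L ≡ just y
                 × x % 2 ≡ (m ∸ 1) % 2 × y % 2 ≡ 1 % 2

module Submission where

-- Proof idea: follow the sizes of the sets.  The initial family
-- S_0 ⊆ S_1 ⊆ … ⊆ S_m with |S_j| = j is a graded chain, and a move with
-- index i replaces S_i by N = S_{i-1} ∪ (S_{i+1} ∖ S_i), which satisfies
-- S_{i-1} ⊆ N ⊆ S_{i+1} and |N| = i.  So every move keeps a graded chain and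
-- produces a set of size i: the sizes of all sets met by a stepping sequence
-- S are  0, 1, …, m  followed by S itself.  Weight a size k by its sign
-- (-1)^k and let alt be the sum of the signs of a list of sizes.  These sets
-- are all subsets, each once, and half the subsets of a nonempty set have
-- even size, so  alt [0,…,m] + alt S = 0.  In a contiguous list from x to y
-- the signs alternate, so twice its alt is  sign x + sign y;  applied to
-- [0,…,m] and to S this yields  sign x + sign y = sign (m-1) + sign 1.  Both
-- sides are sums of two units ±1, hence {sign x, sign y} = {sign (m-1),
-- sign 1}, which is the claim for S or for its reverse.  For m ≥ 2 the
-- sequence is nonempty because {2} is not an initial set.

open import Defs
open import Data.Nat using (ℕ; zero; suc; _≤_; _<_; _∸_; _%_; _≡ᵇ_; _≟_; z≤n; s≤s) renaming (_+_ to _+ᴺ_)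
import Data.Nat.Properties as ℕ
open import Data.Integer using (ℤ; 0ℤ; 1ℤ; -1ℤ; _+_; -_)
open import Data.Integer.Properties
  using (+-0-isCommutativeMonoid; +-assoc; +-identityˡ; +-identityʳ; +-inverseʳ; neg-distrib-+; neg-involutive)
open import Data.Integer.Tactic.RingSolver using (solve-∀)
open import Data.Bool using (true; false)
import Data.Bool as Bool
open import Data.Bool.Properties using (T-≡; ≤-minimum)
open import Data.Vec using ([]; _∷_)
open import Data.Vec.Relation.Binary.Pointwise.Inductive using (Pointwise; []; _∷_)
open import Data.Fin.Subset using (Subset; _∪_; _∩_; ∁; ∣_∣)
open import Data.List using (List; []; _∷_; map; _++_; _∷ʳ_; foldr; upTo; head; last; reverse)
open import Data.List.Properties using (map-++; map-∘; map-id-local; upTo-∷ʳ; unfold-reverse; reverse-involutive)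
open import Data.List.Relation.Unary.All using (All; []; _∷_)
import Data.List.Relation.Unary.All as All
open import Data.List.Relation.Unary.All.Properties using (all-upTo)
open import Data.List.Relation.Unary.Linked using (_∷_)
open import Data.List.Relation.Unary.Linked.Properties using (applyUpTo⁺₂)
open import Data.List.Relation.Unary.Any using (here)
open import Data.List.Relation.Unary.Unique.Propositional using (Unique)
import Data.List.Relation.Unary.Unique.Propositional.Properties as Unique
import Data.List.Relation.Unary.AllPairs as AllPairs
open import Data.List.Membership.Propositional using (_∈_)
open import Data.List.Membership.Propositional.Properties using (∈-map⁺; ∈-map⁻; ∈-++⁺ˡ; ∈-++⁺ʳ; ∈-++⁻)
open import Data.List.Membership.Propositional.Properties.WithK using (unique∧set⇒bag)
open import Data.List.Relation.Binary.BagAndSetEquality using (∼bag⇒↭)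
open import Data.List.Relation.Binary.Permutation.Propositional using (_↭_; ↭⇒↭ₛ)
open import Data.List.Relation.Binary.Permutation.Propositional.Properties using (map⁺)
open import Data.List.Relation.Binary.Permutation.Setoid.Properties using (foldr-commMonoid)
open import Data.Maybe using (just)
open import Data.Product using (∃; _×_; _,_; proj₁; proj₂)
open import Data.Sum using (_⊎_; inj₁; inj₂)
open import Data.Empty using (⊥-elim)
open import Function.Bundles using (mk⇔; Equivalence)
open import Relation.Nullary using (¬_; yes; no)
open import Relation.Binary.PropositionalEquality
  using (_≡_; _≢_; refl; sym; trans; cong; cong₂; setoid; module ≡-Reasoning)

sign : ℕ → ℤ
sign zero          = 1ℤ
sign (suc zero)    = -1ℤ
sign (suc (suc k)) = sign k

sign-suc : ∀ k → sign (suc k) ≡ - sign k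
sign-suc zero          = refl
sign-suc (suc zero)    = refl
sign-suc (suc (suc k)) = sign-suc k

sign≡⇒%2≡ : ∀ x y → sign x ≡ sign y → x % 2 ≡ y % 2
sign≡⇒%2≡ (suc (suc x)) y             e  = sign≡⇒%2≡ x y e
sign≡⇒%2≡ zero          (suc (suc y)) e  = sign≡⇒%2≡ zero y e
sign≡⇒%2≡ (suc zero)    (suc (suc y)) e  = sign≡⇒%2≡ (suc zero) y e
sign≡⇒%2≡ zero          zero          _  = refl
sign≡⇒%2≡ (suc zero)    (suc zero)    _  = refl
sign≡⇒%2≡ zero          (suc zero)    ()
sign≡⇒%2≡ (suc zero)    zero          ()

Unit : ℤ → Set
Unit a = a ≡ 1ℤ ⊎ a ≡ -1ℤ

pattern one       = inj₁ refl
pattern minus-one = inj₂ refl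

sign-unit : ∀ k → Unit (sign k)
sign-unit zero          = one
sign-unit (suc zero)    = minus-one
sign-unit (suc (suc k)) = sign-unit k

units-match : ∀ {a b c d} → Unit a → Unit b → Unit c → Unit d →
              a + b ≡ c + d → (a ≡ c × b ≡ d) ⊎ (a ≡ d × b ≡ c)
units-match one       one       one       one       _  = inj₁ (refl , refl)
units-match one       one       one       minus-one ()
units-match one       one       minus-one one       ()
units-match one       one       minus-one minus-one ()
units-match one       minus-one one       one       ()
units-match one       minus-one one       minus-one _  = inj₁ (refl , refl)
units-match one       minus-one minus-one one       _  = inj₂ (refl , refl)
units-match one       minus-one minus-one minus-one ()
units-match minus-one one       one       one       ()
units-match minus-one one       one       minus-one _  = inj₂ (refl , refl)
units-match minus-one one       minus-one one       _  = inj₁ (refl , refl)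
units-match minus-one one       minus-one minus-one ()
units-match minus-one minus-one one       one       ()
units-match minus-one minus-one one       minus-one ()
units-match minus-one minus-one minus-one one       ()
units-match minus-one minus-one minus-one minus-one _  = inj₁ (refl , refl)

alt : List ℕ → ℤ
alt xs = foldr _+_ 0ℤ (map sign xs)

alt-++ : ∀ xs ys → alt (xs ++ ys) ≡ alt xs + alt ys
alt-++ []       ys = sym (+-identityˡ (alt ys))
alt-++ (x ∷ xs) ys = trans (cong (sign x +_) (alt-++ xs ys)) (sym (+-assoc (sign x) (alt xs) (alt ys)))

alt-map-suc : ∀ xs → alt (map suc xs) ≡ - alt xs
alt-map-suc []       = refl
alt-map-suc (x ∷ xs) = begin
  sign (suc x) + alt (map suc xs) ≡⟨ cong₂ _+_ (sign-suc x) (alt-map-suc xs) ⟩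
  - sign x + - alt xs             ≡⟨ neg-distrib-+ (sign x) (alt xs) ⟨
  - (sign x + alt xs)             ∎
  where open ≡-Reasoning

alt-↭ : ∀ {xs ys} → xs ↭ ys → alt xs ≡ alt ys
alt-↭ p = foldr-commMonoid (setoid ℤ) +-0-isCommutativeMonoid (↭⇒↭ₛ (map⁺ sign p))

adjacent-signs : ∀ {x z} → z ≡ suc x ⊎ x ≡ suc z → sign z ≡ - sign x
adjacent-signs {x} (inj₁ refl) = sign-suc x
adjacent-signs {z = z} (inj₂ refl) = begin
  sign z         ≡⟨ neg-involutive (sign z) ⟨
  - - sign z     ≡⟨ cong -_ (sign-suc z) ⟨
  - sign (suc z) ∎
  where open ≡-Reasoning

-- The signs along a contiguous list alternate, so twice its signed count
-- is the sum of the signs of its two ends.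
contiguous-alt : ∀ {x xs y} → Contiguous (x ∷ xs) → last (x ∷ xs) ≡ just y →
                 alt (x ∷ xs) + alt (x ∷ xs) ≡ sign x + sign y
contiguous-alt {x} {[]} _ refl = cong (λ s → s + s) (+-identityʳ (sign x))
contiguous-alt {x} {z ∷ zs} {y} (x~z ∷ rest) last≡y = begin
  (sign x + a) + (sign x + a)     ≡⟨ regroup (sign x) a ⟩
  (sign x + sign x) + (a + a)     ≡⟨ cong ((sign x + sign x) +_) (contiguous-alt rest last≡y) ⟩
  (sign x + sign x) + (sign z + sign y)
    ≡⟨ cong (λ s → (sign x + sign x) + (s + sign y)) (adjacent-signs x~z) ⟩
  (sign x + sign x) + (- sign x + sign y) ≡⟨ cancel (sign x) (sign y) ⟩
  sign x + sign y                 ∎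
  where
  open ≡-Reasoning
  a = alt (z ∷ zs)
  regroup : ∀ s t → (s + t) + (s + t) ≡ (s + s) + (t + t)
  regroup = solve-∀
  cancel : ∀ s t → (s + s) + (- s + t) ≡ s + t
  cancel = solve-∀

last-∷ʳ : ∀ {A : Set} (xs : List A) x → last (xs ∷ʳ x) ≡ just x
last-∷ʳ []           x = refl
last-∷ʳ (_ ∷ [])     x = refl
last-∷ʳ (_ ∷ y ∷ ys) x = last-∷ʳ (y ∷ ys) x

alt-upTo : ∀ n → alt (upTo (suc n)) + alt (upTo (suc n)) ≡ 1ℤ + sign n
alt-upTo n = contiguous-alt (applyUpTo⁺₂ (λ i → i) (suc n) (λ _ → inj₁ refl)) last≡n
  where
  last≡n : last (upTo (suc n)) ≡ just n
  last≡n = trans (cong last (sym (upTo-∷ʳ n))) (last-∷ʳ (upTo n) n)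

subsets : (n : ℕ) → List (Subset n)
subsets zero    = [] ∷ []
subsets (suc n) = map (false ∷_) (subsets n) ++ map (true ∷_) (subsets n)

subsets-complete : ∀ {n} (A : Subset n) → A ∈ subsets n
subsets-complete []                  = here refl
subsets-complete {suc n} (false ∷ A) = ∈-++⁺ˡ (∈-map⁺ (false ∷_) (subsets-complete A))
subsets-complete {suc n} (true ∷ A)  =
  ∈-++⁺ʳ (map (false ∷_) (subsets n)) (∈-map⁺ (true ∷_) (subsets-complete A))

subsets-unique : ∀ n → Unique (subsets n)
subsets-unique zero    = [] AllPairs.∷ AllPairs.[]
subsets-unique (suc n) =
  Unique.++⁺ (Unique.map⁺ tail-injective (subsets-unique n))
             (Unique.map⁺ tail-injective (subsets-unique n))
             disjoint
  where
  tail-injective : ∀ {b} {A B : Subset n} → (b ∷ A) ≡ (b ∷ B) → A ≡ B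
  tail-injective refl = refl
  disjoint : ∀ {A} → ¬ (A ∈ map (false ∷_) (subsets n) × A ∈ map (true ∷_) (subsets n))
  disjoint (p , q) with ∈-map⁻ (false ∷_) p | ∈-map⁻ (true ∷_) q
  ... | _ , _ , refl | _ , _ , ()

-- A nonempty set has as many subsets of even size as of odd size:
-- adding the new element to a subset flips the sign of its size.
alt-subsets : ∀ n → alt (map ∣_∣ (subsets (suc n))) ≡ 0ℤ
alt-subsets n = begin
  alt (map ∣_∣ (map (false ∷_) L ++ map (true ∷_) L))
    ≡⟨ cong alt (map-++ ∣_∣ (map (false ∷_) L) (map (true ∷_) L)) ⟩
  alt (map ∣_∣ (map (false ∷_) L) ++ map ∣_∣ (map (true ∷_) L))
    ≡⟨ alt-++ (map ∣_∣ (map (false ∷_) L)) (map ∣_∣ (map (true ∷_) L)) ⟩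
  alt (map ∣_∣ (map (false ∷_) L)) + alt (map ∣_∣ (map (true ∷_) L))
    ≡⟨ cong₂ (λ s t → alt s + alt t) (sym (map-∘ L)) (trans (sym (map-∘ L)) (map-∘ L)) ⟩
  alt (map ∣_∣ L) + alt (map suc (map ∣_∣ L))
    ≡⟨ cong (alt (map ∣_∣ L) +_) (alt-map-suc (map ∣_∣ L)) ⟩
  alt (map ∣_∣ L) + - alt (map ∣_∣ L)
    ≡⟨ +-inverseʳ (alt (map ∣_∣ L)) ⟩
  0ℤ ∎
  where
  open ≡-Reasoning
  L = subsets n

infix 4 _⊑_
_⊑_ : ∀ {n} → Subset n → Subset n → Set
A ⊑ B = Pointwise Bool._≤_ A B

step-lower : ∀ {n} {A B C : Subset n} → A ⊑ B → B ⊑ C → A ⊑ A ∪ (C ∩ ∁ B)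
step-lower []                       []                 = []
step-lower (Bool.f≤t ∷ ab)          (Bool.b≤b ∷ bc)    = Bool.b≤b ∷ step-lower ab bc
step-lower (Bool.b≤b {false} ∷ ab)  (Bool.f≤t ∷ bc)    = Bool.f≤t ∷ step-lower ab bc
step-lower (Bool.b≤b {false} ∷ ab)  (Bool.b≤b ∷ bc)    = Bool.b≤b ∷ step-lower ab bc
step-lower (Bool.b≤b {true} ∷ ab)   (Bool.b≤b ∷ bc)    = Bool.b≤b ∷ step-lower ab bc

step-upper : ∀ {n} {A B C : Subset n} → A ⊑ B → B ⊑ C → A ∪ (C ∩ ∁ B) ⊑ C
step-upper []                       []                 = []
step-upper (Bool.f≤t ∷ ab)          (Bool.b≤b ∷ bc)    = Bool.f≤t ∷ step-upper ab bc
step-upper (Bool.b≤b {false} ∷ ab)  (Bool.f≤t ∷ bc)    = Bool.b≤b ∷ step-upper ab bc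
step-upper (Bool.b≤b {false} ∷ ab)  (Bool.b≤b ∷ bc)    = Bool.b≤b ∷ step-upper ab bc
step-upper (Bool.b≤b {true} ∷ ab)   (Bool.b≤b ∷ bc)    = Bool.b≤b ∷ step-upper ab bc

suc-right : ∀ {a b c d} → a +ᴺ b ≡ c +ᴺ d → a +ᴺ suc b ≡ c +ᴺ suc d
suc-right {a} {b} {c} {d} e = trans (ℕ.+-suc a b) (trans (cong suc e) (sym (ℕ.+-suc c d)))

step-size : ∀ {n} {A B C : Subset n} → A ⊑ B → B ⊑ C →
            ∣ A ∪ (C ∩ ∁ B) ∣ +ᴺ ∣ B ∣ ≡ ∣ A ∣ +ᴺ ∣ C ∣
step-size []                      []              = refl
step-size (Bool.f≤t ∷ ab)         (Bool.b≤b ∷ bc) = suc-right (step-size ab bc)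
step-size (Bool.b≤b {false} ∷ ab) (Bool.f≤t ∷ bc) = trans (cong suc (step-size ab bc)) (sym (ℕ.+-suc _ _))
step-size (Bool.b≤b {false} ∷ ab) (Bool.b≤b ∷ bc) = step-size ab bc
step-size (Bool.b≤b {true} ∷ ab)  (Bool.b≤b ∷ bc) = cong suc (suc-right (step-size ab bc))

move-self : ∀ {n} (S : Family n) i → move S i i ≡ newSet S i
move-self S i rewrite Equivalence.to T-≡ (ℕ.≡⇒≡ᵇ i i refl) = refl

move-other : ∀ {n} (S : Family n) i j → j ≢ i → move S i j ≡ S j
move-other S i j j≢i with j ≡ᵇ i in eq
... | true  = ⊥-elim (j≢i (ℕ.≡ᵇ⇒≡ j i (Equivalence.from T-≡ eq)))
... | false = refl

GradedChain : (n : ℕ) → Family n → Set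
GradedChain n S = (∀ j → j ≤ n → ∣ S j ∣ ≡ j) × (∀ j → j < n → S j ⊑ S (suc j))

initial-size : ∀ n j → j ≤ n → ∣ initS n j ∣ ≡ j
initial-size zero    zero    _         = refl
initial-size (suc n) zero    _         = initial-size n zero z≤n
initial-size (suc n) (suc j) (s≤s j≤n) = cong suc (initial-size n j j≤n)

initial-empty-⊑ : ∀ n (B : Subset n) → initS n 0 ⊑ B
initial-empty-⊑ zero    []      = []
initial-empty-⊑ (suc n) (b ∷ B) = ≤-minimum b ∷ initial-empty-⊑ n B

initial-link : ∀ n j → initS n j ⊑ initS n (suc j)
initial-link zero    j       = []
initial-link (suc n) zero    = Bool.f≤t ∷ initial-empty-⊑ n (initS n 0)
initial-link (suc n) (suc j) = Bool.b≤b ∷ initial-link n j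

initial-chain : ∀ n → GradedChain n (initS n)
initial-chain n = initial-size n , λ j _ → initial-link n j

newSet-fits : ∀ {n} {S : Family n} p → GradedChain n S → suc p < n →
              S p ⊑ newSet S (suc p) × newSet S (suc p) ⊑ S (suc (suc p)) × ∣ newSet S (suc p) ∣ ≡ suc p
newSet-fits {S = S} p (size , link) i<n =
  step-lower lower upper , step-upper lower upper , ℕ.+-cancelʳ-≡ (suc p) _ _ size-eq
  where
  lower : S p ⊑ S (suc p)
  lower = link p (ℕ.<-trans ℕ.≤-refl i<n)
  upper : S (suc p) ⊑ S (suc (suc p))
  upper = link (suc p) i<n
  size-eq : ∣ newSet S (suc p) ∣ +ᴺ suc p ≡ suc p +ᴺ suc p
  size-eq = begin
    ∣ newSet S (suc p) ∣ +ᴺ suc p                ≡⟨ cong (∣ newSet S (suc p) ∣ +ᴺ_) (size (suc p) (ℕ.<⇒≤ i<n)) ⟨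
    ∣ newSet S (suc p) ∣ +ᴺ ∣ S (suc p) ∣        ≡⟨ step-size lower upper ⟩
    ∣ S p ∣ +ᴺ ∣ S (suc (suc p)) ∣               ≡⟨ cong₂ _+ᴺ_ (size p (ℕ.≤-trans (ℕ.n≤1+n p) (ℕ.<⇒≤ i<n))) (size (suc (suc p)) i<n) ⟩
    p +ᴺ suc (suc p)                             ≡⟨ ℕ.+-suc p (suc p) ⟩
    suc p +ᴺ suc p                               ∎
    where open ≡-Reasoning

move-chain : ∀ {n} (S : Family n) p → GradedChain n S → suc p < n →
             ∣ newSet S (suc p) ∣ ≡ suc p × GradedChain n (move S (suc p))
move-chain {n} S p chain@(size , link) i<n = new-size , size′ , link′
  where
  i : ℕ
  i = suc p
  fits : S p ⊑ newSet S i × newSet S i ⊑ S (suc i) × ∣ newSet S i ∣ ≡ i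
  fits = newSet-fits p chain i<n
  new-size : ∣ newSet S i ∣ ≡ i
  new-size = proj₂ (proj₂ fits)
  size′ : ∀ j → j ≤ n → ∣ move S i j ∣ ≡ j
  size′ j j≤n with j ≟ i
  ... | yes refl rewrite move-self S i = new-size
  ... | no j≢i rewrite move-other S i j j≢i = size j j≤n
  link′ : ∀ j → j < n → move S i j ⊑ move S i (suc j)
  link′ j j<n with j ≟ i | suc j ≟ i
  ... | yes refl | _ rewrite move-self S i | move-other S i (suc i) ℕ.1+n≢n = proj₁ (proj₂ fits)
  ... | no j≢i | yes refl rewrite move-other S i p j≢i | move-self S i = proj₁ fits
  ... | no j≢i | no 1+j≢i rewrite move-other S i j j≢i | move-other S i (suc j) 1+j≢i = link j j<n

inner-index : ∀ {n p} → suc p ≤ n ∸ 1 → suc p < n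
inner-index {suc n} p<n = s≤s p<n

produced-sizes : ∀ {n} (S : Family n) seq → GradedChain n S →
                 All (λ i → 1 ≤ i × i ≤ n ∸ 1) seq → map ∣_∣ (produced S seq) ≡ seq
produced-sizes S []            _     []                              = refl
produced-sizes S (suc p ∷ seq) chain ((s≤s z≤n , i≤n-1) ∷ valid)
  with move-chain S p chain (inner-index i≤n-1)
... | new-size , chain′ = cong₂ _∷_ new-size (produced-sizes (move S (suc p)) seq chain′ valid)

allSets-sizes : ∀ n seq → All (λ i → 1 ≤ i × i ≤ n ∸ 1) seq →
                map ∣_∣ (allSets n seq) ≡ upTo (suc n) ++ seq
allSets-sizes n seq valid = begin
  map ∣_∣ (map (initS n) (upTo (suc n)) ++ produced (initS n) seq)
    ≡⟨ map-++ ∣_∣ (map (initS n) (upTo (suc n))) (produced (initS n) seq) ⟩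
  map ∣_∣ (map (initS n) (upTo (suc n))) ++ map ∣_∣ (produced (initS n) seq)
    ≡⟨ cong₂ _++_ initial-sizes (produced-sizes (initS n) seq (initial-chain n) valid) ⟩
  upTo (suc n) ++ seq ∎
  where
  open ≡-Reasoning
  initial-sizes : map ∣_∣ (map (initS n) (upTo (suc n))) ≡ upTo (suc n)
  initial-sizes = trans (sym (map-∘ (upTo (suc n))))
    (map-id-local (All.map (λ {j} j<1+n → initial-size n j (ℕ.≤-pred j<1+n)) (all-upTo (suc n))))

stepping-permutes : ∀ {n seq} → IsStepping n seq → allSets n seq ↭ subsets n
stepping-permutes {n} (_ , unique , complete) =
  ∼bag⇒↭ (unique∧set⇒bag unique (subsets-unique n)
           (λ {A} → mk⇔ (λ _ → subsets-complete A) (λ _ → complete A)))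

stepping-balance : ∀ n {S} → IsStepping (suc n) S → alt (upTo (suc (suc n))) + alt S ≡ 0ℤ
stepping-balance n {S} stepping@(valid , _ , _) = begin
  alt (upTo (suc (suc n))) + alt S         ≡⟨ alt-++ (upTo (suc (suc n))) S ⟨
  alt (upTo (suc (suc n)) ++ S)            ≡⟨ cong alt (allSets-sizes (suc n) S valid) ⟨
  alt (map ∣_∣ (allSets (suc n) S))        ≡⟨ alt-↭ (map⁺ ∣_∣ (stepping-permutes stepping)) ⟩
  alt (map ∣_∣ (subsets (suc n)))          ≡⟨ alt-subsets n ⟩
  0ℤ                                       ∎
  where open ≡-Reasoning

end-signs : ∀ n {x xs y} → IsStepping (suc n) (x ∷ xs) → Contiguous (x ∷ xs) →
            last (x ∷ xs) ≡ just y → sign x + sign y ≡ sign n + sign 1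
end-signs n {x} {xs} {y} stepping contiguous last≡y = begin
  sign x + sign y                 ≡⟨ contiguous-alt contiguous last≡y ⟨
  b + b                           ≡⟨ isolate a b ⟩
  (a + b) + (a + b) + - (a + a)   ≡⟨ cong₂ (λ s t → s + s + - t) (stepping-balance n stepping) (alt-upTo (suc n)) ⟩
  0ℤ + 0ℤ + - (1ℤ + sign (suc n)) ≡⟨ cong (λ s → 0ℤ + 0ℤ + - (1ℤ + s)) (sign-suc n) ⟩
  0ℤ + 0ℤ + - (1ℤ + - sign n)     ≡⟨ rearrange (sign n) ⟩
  sign n + -1ℤ                    ∎
  where
  open ≡-Reasoning
  a b : ℤ
  a = alt (upTo (suc (suc n)))
  b = alt (x ∷ xs)
  isolate : ∀ s t → t + t ≡ (s + t) + (s + t) + - (s + s)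
  isolate = solve-∀
  rearrange : ∀ s → 0ℤ + 0ℤ + - (1ℤ + - s) ≡ s + -1ℤ
  rearrange = solve-∀

-- The subset {2} is not an initial set, so a stepping sequence for n ≥ 2 is
-- nonempty.
two-not-initial : ∀ k j → (false ∷ true ∷ initS k 0) ≢ initS (suc (suc k)) j
two-not-initial k zero    ()
two-not-initial k (suc j) ()

stepping-nonempty : ∀ k → ¬ IsStepping (suc (suc k)) []
stepping-nonempty k (_ , _ , complete)
  with ∈-++⁻ (map (initS (suc (suc k))) (upTo (suc (suc (suc k))))) (complete (false ∷ true ∷ initS k 0))
... | inj₂ ()
... | inj₁ two∈initial with ∈-map⁻ (initS (suc (suc k))) {xs = upTo (suc (suc (suc k)))} two∈initial
... | j , _ , two≡Sj = two-not-initial k j two≡Sj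

last-exists : ∀ {A : Set} (x : A) xs → ∃ λ y → last (x ∷ xs) ≡ just y
last-exists x []       = x , refl
last-exists x (z ∷ zs) = last-exists z zs

last-reverse : ∀ {A : Set} (xs : List A) → last (reverse xs) ≡ head xs
last-reverse []       = refl
last-reverse (x ∷ xs) = trans (cong last (unfold-reverse x xs)) (last-∷ʳ (reverse xs) x)

head-reverse : ∀ {A : Set} (xs : List A) → head (reverse xs) ≡ last xs
head-reverse xs = trans (sym (last-reverse (reverse xs))) (cong last (reverse-involutive xs))

lemma6p4 : (m : ℕ) → 2 ≤ m → (S : List ℕ) → IsStepping m S → Contiguous S →
    GoodEnds m S ⊎ GoodEnds m (reverse S)
lemma6p4 (suc (suc k)) (s≤s (s≤s _)) [] stepping _ = ⊥-elim (stepping-nonempty k stepping)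
lemma6p4 (suc (suc k)) (s≤s (s≤s _)) (x ∷ xs) stepping contiguous
  with last-exists x xs
... | y , last≡y
  with units-match (sign-unit x) (sign-unit y) (sign-unit (suc k)) (sign-unit 1)
                   (end-signs (suc k) stepping contiguous last≡y)
... | inj₁ (x~m-1 , y~1) =
  inj₁ (x , y , refl , last≡y , sign≡⇒%2≡ x (suc k) x~m-1 , sign≡⇒%2≡ y 1 y~1)
... | inj₂ (x~1 , y~m-1) =
  inj₂ (y , x , trans (head-reverse (x ∷ xs)) last≡y , last-reverse (x ∷ xs) ,
        sign≡⇒%2≡ y (suc k) y~m-1 , sign≡⇒%2≡ x 1 x~1)
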